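{- Let $H$ be a hypergraph and $k>0$ a real number. Let $S\subseteq V(H)$ be such that $\rho^*(S)>3k$, and suppose $fhw(H)\le k$. Then $S$ has a balanced fractional separator $X$ with $\rho^*(X)\le k$.
   Context: A hypergraph $H$ has a finite vertex set $V(H)$ and a family $E(H)$ of subsets (hyperedges), with no isolated vertices. For $U\subseteq V(H)$, $H[U]$ has vertex set $U$ and hyperedges $\{e\cap U: e\in E(H), e\cap U\ne\emptyset\}$, and $H\setminus U=H[V(H)\setminus U]$; connected components are defined via paths (vertex sequences with consecutive vertices in a common hyperedge). $\rho^*(U)$ is the minimum of $\sum_e\gamma(e)$ over $\gamma:E(H)\to[0,1]$ with $\sum_{e\ni u}\gamma(e)\ge1$ for all $u\in U$. $X$ is a balanced fractional separator for $S$ if every connected component $V'$ of $H\setminus X$ satisfies $\rho^*(V'\cap S)<\frac23\rho^*(S)$. A tree decomposition $(T,\mathbf{B})$ of $H$: $T$ a tree, bags $\mathbf{B}(x)\subseteq V(H)$ covering $V(H)$, each hyperedge inside some bag, and for each vertex the nodes containing it induce a connected subtree. $fhw(H)$ is the minimum over tree decompositions of $\max_x\rho^*(\mathbf{B}(x))$.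
   Formalization: The parameter k is a positive rational rather than a real number, and the fractional covers γ defining ρ* take rational values in [0,1]. -}

module Defs where

open import Data.Nat using (ℕ; zero; suc)
open import Data.Fin using (Fin; zero; suc; toℕ)
open import Data.Fin.Subset using (Subset; _∈_; _∉_)
open import Data.Integer using (+_)
open import Data.Rational using (ℚ; 0ℚ; 1ℚ; _+_; _*_; _≤_; _<_; _/_)
open import Data.Product using (Σ; ∃; ∃-syntax; _×_)
open import Data.Sum using (_⊎_)
open import Relation.Binary.PropositionalEquality using (_≡_)
open import Relation.Binary.Construct.Closure.ReflexiveTransitive using (Star)
open import Function.Bundles using (_⇔_)
open import Data.Fin.Subset.Properties using (_∈?_)
open import Relation.Nullary using (yes; no)
import Data.Nat

-- A hypergraph on vertex set Fin n with a family of m hyperedges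
-- (indexed, so repetitions are allowed), no isolated vertices.
record Hypergraph : Set where
  field
    n      : ℕ
    m      : ℕ
    edge   : Fin m → Subset n
    noIsolated : ∀ (v : Fin n) → ∃[ e ] (v ∈ edge e)
open Hypergraph public

VSet : ℕ → Set₁
VSet n = Fin n → Set

sumℚ : ∀ {m} → (Fin m → ℚ) → ℚ
sumℚ {zero}  f = 0ℚ
sumℚ {suc m} f = f zero + sumℚ (λ i → f (suc i))

sumContaining : (H : Hypergraph) → (Fin (m H) → ℚ) → Fin (n H) → ℚ
sumContaining H γ u = sumℚ (λ e → γ e * ind e)
  where
    ind : Fin (m H) → ℚ
    ind e with u ∈?  (edge H e)
    ... | yes _ = 1ℚ
    ... | no  _ = 0ℚ

IsFracCover : (H : Hypergraph) → VSet (n H) → (Fin (m H) → ℚ) → Set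
IsFracCover H U γ =
  (∀ e → (0ℚ ≤ γ e) × (γ e ≤ 1ℚ)) ×
  (∀ u → U u → 1ℚ ≤ sumContaining H γ u)

weight : (H : Hypergraph) → (Fin (m H) → ℚ) → ℚ
weight H γ = sumℚ γ

IsRhoStar : (H : Hypergraph) → VSet (n H) → ℚ → Set
IsRhoStar H U r =
  (∃[ γ ] (IsFracCover H U γ × weight H γ ≡ r)) ×
  (∀ γ → IsFracCover H U γ → r ≤ weight H γ)

SetOf : ∀ {k} → Subset k → VSet k
SetOf X v = v ∈ X

_∩ᵖ_ : ∀ {k} → VSet k → VSet k → VSet k
(A ∩ᵖ B) v = A v × B v

-- adjacency in H \ X: u, v both outside X and in a common hyperedge of H
-- (equivalently in a common hyperedge e ∩ (V ∖ X) of H \ X)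
AdjOutside : (H : Hypergraph) → Subset (n H) → Fin (n H) → Fin (n H) → Set
AdjOutside H X u v = u ∉ X × v ∉ X × ∃[ e ] (u ∈ edge H e × v ∈ edge H e)

IsComponent : (H : Hypergraph) → Subset (n H) → VSet (n H) → Set
IsComponent H X V' =
  ∃[ u ] (u ∉ X × (∀ v → (V' v ⇔ Star (AdjOutside H X) u v)))

IsBalancedSep : (H : Hypergraph) → Subset (n H) → Subset (n H) → Set₁
IsBalancedSep H S X =
  ∀ (s : ℚ) → IsRhoStar H (SetOf S) s →
  ∀ (V' : VSet (n H)) → IsComponent H X V' →
  ∃[ r ] (IsRhoStar H (V' ∩ᵖ SetOf S) r × r < (+ 2 / 3) * s)

-- Trees: nodes Fin (suc t), node (suc i) has parent `parent i` with smaller index.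
record Tree : Set where
  field
    t      : ℕ
    parent : Fin t → Fin (suc t)
    parentSmaller : ∀ i → toℕ (parent i) Data.Nat.≤ toℕ i
open Tree public

TAdj : (T : Tree) → Fin (suc (t T)) → Fin (suc (t T)) → Set
TAdj T a b = (∃[ i ] (a ≡ suc i × b ≡ parent T i)) ⊎ (∃[ i ] (b ≡ suc i × a ≡ parent T i))

record TreeDecomposition (H : Hypergraph) : Set₁ where
  field
    tree : Tree
    bag  : Fin (suc (t tree)) → Subset (n H)
    coversVertices : ∀ v → ∃[ x ] (v ∈ bag x)
    coversEdges    : ∀ e → ∃[ x ] (∀ v → v ∈ edge H e → v ∈ bag x)
    connectedness  : ∀ v x y → v ∈ bag x → v ∈ bag y →
      Star (λ a b → TAdj tree a b × v ∈ bag a × v ∈ bag b) x y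
open TreeDecomposition public

FhwAtMost : Hypergraph → ℚ → Set₁
FhwAtMost H k = Σ (TreeDecomposition H) λ D →
  ∀ x → ∃[ r ] (IsRhoStar H (SetOf (bag D x)) r × r ≤ k)

-- Let x be a node of largest index whose subtree W satisfies ρ*(S ∩ W) ≥ 2/3 ρ*(S) (the root does); since
-- parents have smaller indices than their children, every child of x fails this. Take X = B(x). A component
-- C of H ∖ X that meets W stays inside the subtree of one child of x, so ρ*(C ∩ S) < 2/3 ρ*(S). Otherwise C
-- avoids W, and S ∖ W shares no hyperedge with (S ∩ W) ∖ X, whence
--   ρ*(C ∩ S) ≤ ρ*(S) − ρ*((S ∩ W) ∖ X) ≤ ρ*(S) − (2/3 ρ*(S) − k) < 2/3 ρ*(S)   as 3k < ρ*(S).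
-- All the values ρ* used here exist because ρ* is a linear program over ℚ whose minimum is attained;
-- this is shown constructively by Fourier–Motzkin elimination.
module Submission where

open import Defs
open import Data.Empty using (⊥)
open import Data.Bool.Properties using (T-≡)
open import Data.Fin using (Fin; zero; suc) renaming (_<_ to _<ᶠ_; _≟_ to _≟ᶠ_)
open import Data.Fin.Induction using (<-wellFounded)
open import Data.Fin.Properties using (any?)
open import Data.Fin.Subset using (Subset; _∈_; _∉_; ⁅_⁆; ∣_∣) renaming (_⊆_ to _⊆ₛ_)
open import Data.Fin.Subset.Properties
  using (_∈?_; p⊂q⇒∣p∣<∣q∣; ∣p∣≤n; ∣⁅x⁆∣≡1; x∈⁅x⁆; x∈⁅y⁆⇒x≡y)
open import Data.Integer using (+_)
open import Data.List using (List; []; _∷_; _++_; map; concat; concatMap; tabulate)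
open import Data.List.Relation.Unary.All as All using (All; []; _∷_)
import Data.List.Relation.Unary.All.Properties as All
import Data.List.Extrema
open import Data.Nat using (ℕ; zero; suc)
import Data.Nat as ℕ
import Data.Nat.Properties as ℕ
open import Data.Product using (Σ; ∃; ∃₂; ∃-syntax; _×_; _,_; proj₁; proj₂)
open import Data.Rational hiding (∣_∣)
open import Data.Rational.Properties
open import Data.Rational.Solver using (module +-*-Solver)
open import Data.Sum using (_⊎_; inj₁; inj₂; [_,_]′)
open import Data.Vec using () renaming (tabulate to tabulateᵥ)
open import Data.Vec.Functional using (head; tail) renaming (_∷_ to _∷ᵥ_)
open import Data.Vec.Properties using (lookup∘tabulate; []=⇒lookup; lookup⇒[]=)
open import Function using (id; _∘_; _⇔_; mk⇔; Equivalence)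
import Function.Properties.Equivalence as ⇔
open import Induction.WellFounded using (Acc; acc)
open import Relation.Binary.Bundles using (DecTotalOrder; TotalOrder)
open import Relation.Binary.Construct.Closure.ReflexiveTransitive using (Star; ε; _◅_; _◅◅_; fold)
open import Relation.Binary.Definitions using (tri<; tri≈; tri>)
open import Relation.Binary.PropositionalEquality
open import Relation.Nullary using (Dec; yes; no; ¬_; contradiction)
open import Relation.Nullary.Decidable
  using (_×-dec_; _⊎-dec_; ¬?; isYes; toWitness; fromWitness; map′; toSum; decidable-stable)
open import Relation.Unary using (Decidable; _⊆_; _∪_; _∩_)

open +-*-Solver
open Equivalence using (to; from)

≤-totalOrder : TotalOrder _ _ _
≤-totalOrder = DecTotalOrder.totalOrder ≤-decTotalOrder

module Extrema = Data.List.Extrema ≤-totalOrder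

0≤1 : 0ℚ ≤ 1ℚ
0≤1 = <⇒≤ (positive⁻¹ 1ℚ)

1/⁺ : ∀ {a} → 0ℚ < a → ℚ
1/⁺ {a} 0<a = (1/ a) {{pos⇒nonZero a {{positive 0<a}}}}

1/⁻ : ∀ {a} → a < 0ℚ → ℚ
1/⁻ {a} a<0 = (1/ a) {{neg⇒nonZero a {{negative a<0}}}}

1/a*[a*x]≡x : ∀ a .{{_ : NonZero a}} x → 1/ a * (a * x) ≡ x
1/a*[a*x]≡x a x = trans (sym (*-assoc (1/ a) a x)) (trans (cong (_* x) (*-inverseˡ a)) (*-identityˡ x))

a*[1/a*x]≡x : ∀ a .{{_ : NonZero a}} x → a * (1/ a * x) ≡ x
a*[1/a*x]≡x a x = trans (sym (*-assoc a (1/ a) x)) (trans (cong (_* x) (*-inverseʳ a)) (*-identityˡ x))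

≤-+⇔-≤ : ∀ b y r → b ≤ y + r ⇔ b - r ≤ y
≤-+⇔-≤ b y r = mk⇔
  (λ b≤y+r → subst (b - r ≤_) (solve 2 (λ y r → y :+ r :- r := y) refl y r) (+-monoˡ-≤ (- r) b≤y+r))
  (λ b-r≤y → subst (_≤ y + r) (solve 2 (λ b r → b :- r :+ r := b) refl b r) (+-monoˡ-≤ r b-r≤y))

≤-*-pos : ∀ {a} (0<a : 0ℚ < a) v x → v ≤ a * x ⇔ 1/⁺ 0<a * v ≤ x
≤-*-pos {a} 0<a v x = mk⇔
  (λ v≤ax → subst (1/ a * v ≤_) (1/a*[a*x]≡x a x)
                  (*-monoˡ-≤-nonNeg (1/ a) {{pos⇒nonNeg (1/ a) {{1/pos⇒pos a}}}} v≤ax))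
  (λ v/a≤x → subst (_≤ a * x) (a*[1/a*x]≡x a v) (*-monoˡ-≤-nonNeg a {{pos⇒nonNeg a}} v/a≤x))
  where instance
    _ = positive 0<a
    _ = pos⇒nonZero a

≤-*-neg : ∀ {a} (a<0 : a < 0ℚ) v x → v ≤ a * x ⇔ x ≤ 1/⁻ a<0 * v
≤-*-neg {a} a<0 v x = mk⇔
  (λ v≤ax → subst (_≤ 1/ a * v) (1/a*[a*x]≡x a x)
                  (*-monoˡ-≤-nonPos (1/ a) {{neg⇒nonPos (1/ a) {{1/neg⇒neg a}}}} v≤ax))
  (λ x≤v/a → subst (_≤ a * x) (a*[1/a*x]≡x a v) (*-monoˡ-≤-nonPos a {{neg⇒nonPos a}} x≤v/a))
  where instance
    _ = negative a<0
    _ = neg⇒nonZero a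

≤-resp-difference : ∀ {x y x′ y′} → y - x ≡ y′ - x′ → x ≤ y → x′ ≤ y′
≤-resp-difference {x} {y} {x′} {y′} eq x≤y =
  subst₂ _≤_ (+-identityˡ x′) (solve 2 (λ x y → y :- x :+ x := y) refl x′ y′)
    (+-monoˡ-≤ x′ (subst₂ _≤_ (+-inverseʳ x) eq (+-monoˡ-≤ (- x) x≤y)))

≤⇔-difference : ∀ {x y x′ y′} → y - x ≡ y′ - x′ → x ≤ y ⇔ x′ ≤ y′
≤⇔-difference eq = mk⇔ (≤-resp-difference eq) (≤-resp-difference (sym eq))

interpolate : ∀ {A B : Set} (f : A → ℚ) (g : B → ℚ) (as : List A) (bs : List B) →
  All (λ a → All (λ b → f a ≤ g b) bs) as → ∃[ t ] (All (λ a → f a ≤ t) as × All (λ b → t ≤ g b) bs)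
interpolate f g (a ∷ as) bs (fa≤g ∷ fas≤g) =
  f (argmax f a as) , f[⊥]≤f[argmax] {f = f} a as ∷ f[xs]≤f[argmax] {f = f} a as ,
  All.tabulate (λ b∈bs → f[argmax]≤v⁺ (All.lookup fa≤g b∈bs)
                                       (All.map (λ fa′≤g → All.lookup fa′≤g b∈bs) fas≤g))
  where open Extrema
interpolate f g [] (b ∷ bs) _ = g (argmin g b bs) , [] , f[argmin]≤f[⊤] {f = g} b bs ∷ f[argmin]≤f[xs] {f = g} b bs
  where open Extrema
interpolate f g [] [] _ = 0ℚ , [] , []

sumℚ-cong : ∀ {k} {f g : Fin k → ℚ} → (∀ i → f i ≡ g i) → sumℚ f ≡ sumℚ g
sumℚ-cong {zero}  f≗g = refl
sumℚ-cong {suc k} f≗g = cong₂ _+_ (f≗g zero) (sumℚ-cong (f≗g ∘ suc))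

sumℚ-mono : ∀ {k} {f g : Fin k → ℚ} → (∀ i → f i ≤ g i) → sumℚ f ≤ sumℚ g
sumℚ-mono {zero}  f≤g = ≤-refl
sumℚ-mono {suc k} f≤g = +-mono-≤ (f≤g zero) (sumℚ-mono (f≤g ∘ suc))

sumℚ-nonNeg : ∀ {k} {f : Fin k → ℚ} → (∀ i → 0ℚ ≤ f i) → 0ℚ ≤ sumℚ f
sumℚ-nonNeg {zero}  0≤f = ≤-refl
sumℚ-nonNeg {suc k} 0≤f = +-mono-≤ (0≤f zero) (sumℚ-nonNeg (0≤f ∘ suc))

≤-sumℚ : ∀ {k} {f : Fin k → ℚ} → (∀ i → 0ℚ ≤ f i) → ∀ i → f i ≤ sumℚ f
≤-sumℚ {suc k} {f} 0≤f zero    =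
  subst (_≤ sumℚ f) (+-identityʳ (f zero)) (+-monoʳ-≤ (f zero) (sumℚ-nonNeg (0≤f ∘ suc)))
≤-sumℚ {suc k} {f} 0≤f (suc i) =
  subst (_≤ sumℚ f) (+-identityˡ (f (suc i))) (+-mono-≤ (0≤f zero) (≤-sumℚ (0≤f ∘ suc) i))

sumℚ-+ : ∀ {k} (f g : Fin k → ℚ) → sumℚ (λ i → f i + g i) ≡ sumℚ f + sumℚ g
sumℚ-+ {zero}  f g = refl
sumℚ-+ {suc k} f g = trans (cong (_+_ (f zero + g zero)) (sumℚ-+ (f ∘ suc) (g ∘ suc)))
  (solve 4 (λ a b c d → (a :+ b) :+ (c :+ d) := (a :+ c) :+ (b :+ d)) refl
     (f zero) (g zero) (sumℚ (f ∘ suc)) (sumℚ (g ∘ suc)))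

infixl 7 _·_

_·_ : ∀ {k} → (Fin k → ℚ) → (Fin k → ℚ) → ℚ
a · x = sumℚ (λ i → a i * x i)

·-linear : ∀ {k} α β (a b x : Fin k → ℚ) → (λ i → α * a i + β * b i) · x ≡ α * (a · x) + β * (b · x)
·-linear {zero}  α β a b x = solve 2 (λ α β → con 0ℚ := α :* con 0ℚ :+ β :* con 0ℚ) refl α β
·-linear {suc k} α β a b x =
  trans (cong (_+_ ((α * a zero + β * b zero) * x zero)) (·-linear α β (a ∘ suc) (b ∘ suc) (x ∘ suc)))
    (solve 7 (λ α β a₀ b₀ x₀ A B → (α :* a₀ :+ β :* b₀) :* x₀ :+ (α :* A :+ β :* B)
                                 := α :* (a₀ :* x₀ :+ A) :+ β :* (b₀ :* x₀ :+ B))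
      refl α β (a zero) (b zero) (x zero) ((a ∘ suc) · (x ∘ suc)) ((b ∘ suc) · (x ∘ suc)))

·-const : ∀ {k} c (x : Fin k → ℚ) → (λ _ → c) · x ≡ c * sumℚ x
·-const {zero}  c x = sym (*-zeroʳ c)
·-const {suc k} c x =
  trans (cong (_+_ (c * x zero)) (·-const c (x ∘ suc))) (sym (*-distribˡ-+ c (x zero) (sumℚ (x ∘ suc))))

unit : ∀ {k} → ℚ → Fin k → Fin k → ℚ
unit v zero    zero    = v
unit v zero    (suc _) = 0ℚ
unit v (suc i) zero    = 0ℚ
unit v (suc i) (suc j) = unit v i j

unit-· : ∀ {k} v (i : Fin k) (x : Fin k → ℚ) → unit v i · x ≡ v * x i
unit-· v zero    x = trans (cong (_+_ (v * x zero)) (trans (·-const 0ℚ (x ∘ suc)) (*-zeroˡ (sumℚ (x ∘ suc)))))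
                          (+-identityʳ (v * x zero))
unit-· v (suc i) x = trans (cong (_+_ (0ℚ * x zero)) (unit-· v i (x ∘ suc)))
                          (solve 2 (λ x₀ y → con 0ℚ :* x₀ :+ y := y) refl (x zero) (v * x (suc i)))

-- Linear programs and Fourier–Motzkin elimination

-- constraint a c b is the inequality  b ≤ a · x + c * w  in the variables x and the objective variable w.
record Constraint (k : ℕ) : Set where
  constructor constraint
  field
    coeff  : Fin k → ℚ
    wCoeff : ℚ
    bound  : ℚ
open Constraint

value : ∀ {k} → Constraint k → (Fin k → ℚ) → ℚ → ℚ
value c x w = coeff c · x + wCoeff c * w

Satisfies : ∀ {k} → (Fin k → ℚ) → ℚ → Constraint k → Set
Satisfies x w c = bound c ≤ value c x w

Satisfies₀ : ℚ → Constraint 0 → Set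
Satisfies₀ = Satisfies (λ ())

linComb : ∀ {k} → ℚ → Constraint k → ℚ → Constraint k → Constraint k
linComb α c β d =
  constraint (λ i → α * coeff c i + β * coeff d i) (α * wCoeff c + β * wCoeff d) (α * bound c + β * bound d)

value-linComb : ∀ {k} α c β d (x : Fin k → ℚ) w →
  value (linComb α c β d) x w ≡ α * value c x w + β * value d x w
value-linComb α c β d x w =
  trans (cong (_+ (α * wCoeff c + β * wCoeff d) * w) (·-linear α β (coeff c) (coeff d) x))
    (solve 7 (λ α β A B p q w → α :* A :+ β :* B :+ (α :* p :+ β :* q) :* w
                              := α :* (A :+ p :* w) :+ β :* (B :+ q :* w))
      refl α β (coeff c · x) (coeff d · x) (wCoeff c) (wCoeff d) w)

module _ {k : ℕ} where

  lead : Constraint (suc k) → ℚ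
  lead c = coeff c zero

  dropLead : Constraint (suc k) → Constraint k
  dropLead c = constraint (coeff c ∘ suc) (wCoeff c) (bound c)

  residual : Constraint (suc k) → (Fin k → ℚ) → ℚ → ℚ
  residual c xs w = bound c - value (dropLead c) xs w

  value-lead : ∀ c x w → value c x w ≡ lead c * head x + value (dropLead c) (tail x) w
  value-lead c x w = +-assoc (lead c * head x) (coeff (dropLead c) · tail x) (wCoeff c * w)

  Satisfies⇔residual≤ : ∀ c x w → Satisfies x w c ⇔ residual c (tail x) w ≤ lead c * head x
  Satisfies⇔residual≤ c x w =
    subst (λ v → bound c ≤ v ⇔ residual c (tail x) w ≤ lead c * head x) (sym (value-lead c x w))
      (≤-+⇔-≤ (bound c) (lead c * head x) (value (dropLead c) (tail x) w))

  LowerBound UpperBound Free : Set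
  LowerBound = Σ (Constraint (suc k)) λ c → 0ℚ < lead c
  UpperBound = Σ (Constraint (suc k)) λ c → lead c < 0ℚ
  Free       = Σ (Constraint (suc k)) λ c → 0ℚ ≡ lead c

  lower : LowerBound → (Fin k → ℚ) → ℚ → ℚ
  lower (c , 0<a) xs w = 1/⁺ 0<a * residual c xs w

  upper : UpperBound → (Fin k → ℚ) → ℚ → ℚ
  upper (c , a<0) xs w = 1/⁻ a<0 * residual c xs w

  Satisfies⇔lower≤ : ∀ (p : LowerBound) x w → Satisfies x w (proj₁ p) ⇔ lower p (tail x) w ≤ head x
  Satisfies⇔lower≤ (c , 0<a) x w = ⇔.trans (Satisfies⇔residual≤ c x w) (≤-*-pos 0<a _ (head x))

  Satisfies⇔≤upper : ∀ (q : UpperBound) x w → Satisfies x w (proj₁ q) ⇔ head x ≤ upper q (tail x) w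
  Satisfies⇔≤upper (c , a<0) x w = ⇔.trans (Satisfies⇔residual≤ c x w) (≤-*-neg a<0 _ (head x))

  Satisfies⇔dropLead : ∀ (z : Free) x w → Satisfies x w (proj₁ z) ⇔ Satisfies (tail x) w (dropLead (proj₁ z))
  Satisfies⇔dropLead (c , 0≡a) x w =
    subst (λ v → bound c ≤ v ⇔ Satisfies (tail x) w (dropLead c)) (sym value≡) ⇔.refl
    where
      value≡ : value c x w ≡ value (dropLead c) (tail x) w
      value≡ = trans (value-lead c x w)
        (trans (cong (λ a → a * head x + value (dropLead c) (tail x) w) (sym 0≡a))
          (solve 2 (λ x₀ v → con 0ℚ :* x₀ :+ v := v) refl (head x) (value (dropLead c) (tail x) w)))

  combine : LowerBound → UpperBound → Constraint k
  combine (p , 0<a) (q , b<0) = linComb (1/⁺ 0<a) (dropLead p) (- 1/⁻ b<0) (dropLead q)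

  Satisfies-combine⇔lower≤upper : ∀ p q xs w → Satisfies xs w (combine p q) ⇔ lower p xs w ≤ upper q xs w
  Satisfies-combine⇔lower≤upper (p , 0<a) (q , b<0) xs w =
    subst (λ v → α * bound p + (- β) * bound q ≤ v ⇔ lower (p , 0<a) xs w ≤ upper (q , b<0) xs w)
          (sym (value-linComb α (dropLead p) (- β) (dropLead q) xs w))
      (≤⇔-difference (difference α β (bound p) (bound q) Vp Vq))
    where
      α = 1/⁺ 0<a
      β = 1/⁻ b<0
      Vp = value (dropLead p) xs w
      Vq = value (dropLead q) xs w
      difference : ∀ α β bp bq Vp Vq →
        (α * Vp + (- β) * Vq) - (α * bp + (- β) * bq) ≡ β * (bq - Vq) - α * (bp - Vp)
      difference = solve 6 (λ α β bp bq Vp Vq → (α :* Vp :+ (:- β) :* Vq) :- (α :* bp :+ (:- β) :* bq)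
                                            := β :* (bq :- Vq) :- α :* (bp :- Vp)) refl

  Partition : Set
  Partition = List LowerBound × List UpperBound × List Free

  partition : List (Constraint (suc k)) → Partition
  partition [] = [] , [] , []
  partition (c ∷ cs) with partition cs | <-cmp 0ℚ (lead c)
  ... | L , U , F | tri< 0<a _ _ = (c , 0<a) ∷ L , U , F
  ... | L , U , F | tri≈ _ 0≡a _ = L , U , (c , 0≡a) ∷ F
  ... | L , U , F | tri> _ _ a<0 = L , (c , a<0) ∷ U , F

  AllParts : (Fin (suc k) → ℚ) → ℚ → Partition → Set
  AllParts x w (L , U , F) =
    All (Satisfies x w ∘ proj₁) L × All (Satisfies x w ∘ proj₁) U × All (Satisfies x w ∘ proj₁) F

  All-partition⁺ : ∀ x w (cs : List (Constraint (suc k))) → All (Satisfies x w) cs → AllParts x w (partition cs)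
  All-partition⁺ x w [] [] = [] , [] , []
  All-partition⁺ x w (c ∷ cs) (s ∷ ss) with partition cs | All-partition⁺ x w cs ss | <-cmp 0ℚ (lead c)
  ... | _ | sL , sU , sF | tri< _ _ _ = s ∷ sL , sU , sF
  ... | _ | sL , sU , sF | tri≈ _ _ _ = sL , sU , s ∷ sF
  ... | _ | sL , sU , sF | tri> _ _ _ = sL , s ∷ sU , sF

  All-partition⁻ : ∀ x w (cs : List (Constraint (suc k))) → AllParts x w (partition cs) → All (Satisfies x w) cs
  All-partition⁻ x w [] _ = []
  All-partition⁻ x w (c ∷ cs) parts with partition cs | All-partition⁻ x w cs | <-cmp 0ℚ (lead c) | parts
  ... | _ | ih | tri< _ _ _ | s ∷ sL , sU , sF = s ∷ ih (sL , sU , sF)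
  ... | _ | ih | tri≈ _ _ _ | sL , sU , s ∷ sF = s ∷ ih (sL , sU , sF)
  ... | _ | ih | tri> _ _ _ | sL , s ∷ sU , sF = s ∷ ih (sL , sU , sF)

  -- A value of the leading variable exists iff every lower bound on it lies below every upper bound.
  eliminateParts : Partition → List (Constraint k)
  eliminateParts (L , U , F) = map (dropLead ∘ proj₁) F ++ concatMap (λ p → map (combine p) U) L

  eliminate : List (Constraint (suc k)) → List (Constraint k)
  eliminate = eliminateParts ∘ partition

  eliminateParts-sound : ∀ x w P → AllParts x w P → All (Satisfies (tail x) w) (eliminateParts P)
  eliminateParts-sound x w (L , U , F) (sL , sU , sF) =
    All.++⁺ (All.map⁺ (All.map (λ {z} → to (Satisfies⇔dropLead z x w)) sF))
            (All.concat⁺ (All.map⁺ (All.map (λ {p} sp → All.map⁺ (All.map (λ {q} → combined p q sp) sU)) sL)))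
    where
      combined : ∀ p q → Satisfies x w (proj₁ p) → Satisfies x w (proj₁ q) → Satisfies (tail x) w (combine p q)
      combined p q sp sq = from (Satisfies-combine⇔lower≤upper p q (tail x) w)
        (≤-trans (to (Satisfies⇔lower≤ p x w) sp) (to (Satisfies⇔≤upper q x w) sq))

  eliminateParts-complete : ∀ xs w P → All (Satisfies xs w) (eliminateParts P) → ∃[ x₀ ] AllParts (x₀ ∷ᵥ xs) w P
  eliminateParts-complete xs w (L , U , F) s =
    x₀ , All.map (λ {p} → from (Satisfies⇔lower≤ p (x₀ ∷ᵥ xs) w)) lower≤x₀
       , All.map (λ {q} → from (Satisfies⇔≤upper q (x₀ ∷ᵥ xs) w)) x₀≤upper
       , All.map (λ {z} → from (Satisfies⇔dropLead z (x₀ ∷ᵥ xs) w)) (All.map⁻ (proj₁ (All.++⁻ _ s)))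
    where
      lower≤upper : All (λ p → All (λ q → lower p xs w ≤ upper q xs w) U) L
      lower≤upper = All.map (λ {p} sp → All.map (λ {q} → to (Satisfies-combine⇔lower≤upper p q xs w))
                                                (All.map⁻ sp))
                            (All.map⁻ (All.concat⁻ (proj₂ (All.++⁻ _ s))))
      between : ∃[ t ] (All (λ p → lower p xs w ≤ t) L × All (λ q → t ≤ upper q xs w) U)
      between = interpolate (λ p → lower p xs w) (λ q → upper q xs w) L U lower≤upper
      x₀ = proj₁ between
      lower≤x₀ = proj₁ (proj₂ between)
      x₀≤upper = proj₂ (proj₂ between)

  eliminate-sound : ∀ x w (cs : List (Constraint (suc k))) →
    All (Satisfies x w) cs → All (Satisfies (tail x) w) (eliminate cs)
  eliminate-sound x w cs s = eliminateParts-sound x w (partition cs) (All-partition⁺ x w cs s)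

  eliminate-complete : ∀ xs w (cs : List (Constraint (suc k))) →
    All (Satisfies xs w) (eliminate cs) → ∃[ x₀ ] All (Satisfies (x₀ ∷ᵥ xs) w) cs
  eliminate-complete xs w cs s = x₀ , All-partition⁻ (x₀ ∷ᵥ xs) w cs parts
    where
      x₀ = proj₁ (eliminateParts-complete xs w (partition cs) s)
      parts = proj₂ (eliminateParts-complete xs w (partition cs) s)

eliminateAll : ∀ {k} → List (Constraint k) → List (Constraint 0)
eliminateAll {zero}  cs = cs
eliminateAll {suc k} cs = eliminateAll (eliminate cs)

eliminateAll-sound : ∀ {k} x w (cs : List (Constraint k)) →
  All (Satisfies x w) cs → All (Satisfies₀ w) (eliminateAll cs)
eliminateAll-sound {zero}  x w cs s = s
eliminateAll-sound {suc k} x w cs s = eliminateAll-sound (tail x) w (eliminate cs) (eliminate-sound x w cs s)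

eliminateAll-complete : ∀ {k} w (cs : List (Constraint k)) → All (Satisfies₀ w) (eliminateAll cs) →
  ∃[ x ] All (Satisfies x w) cs
eliminateAll-complete {zero}  w cs s = (λ ()) , s
eliminateAll-complete {suc k} w cs s = x₀ ∷ᵥ xs , proj₂ (eliminate-complete xs w cs sxs)
  where
    xs = proj₁ (eliminateAll-complete w (eliminate cs) s)
    sxs = proj₂ (eliminateAll-complete w (eliminate cs) s)
    x₀ = proj₁ (eliminate-complete xs w cs sxs)

Satisfies₀⇔ : ∀ w c → Satisfies₀ w c ⇔ bound c ≤ wCoeff c * w
Satisfies₀⇔ w c = subst (λ v → bound c ≤ v ⇔ bound c ≤ wCoeff c * w) (sym (+-identityˡ (wCoeff c * w))) ⇔.refl

-- 0 when c gives no lower bound on w; only w ≥ 0 is considered below.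
lowerLimit : Constraint 0 → ℚ
lowerLimit c with <-cmp 0ℚ (wCoeff c)
... | tri< 0<a _ _ = 1/⁺ 0<a * bound c
... | _            = 0ℚ

lowerLimit≤ : ∀ {w} c → 0ℚ ≤ w → Satisfies₀ w c → lowerLimit c ≤ w
lowerLimit≤ {w} c 0≤w s with <-cmp 0ℚ (wCoeff c)
... | tri< 0<a _ _ = to (≤-*-pos 0<a (bound c) w) (to (Satisfies₀⇔ w c) s)
... | tri≈ _ _ _   = 0≤w
... | tri> _ _ _   = 0≤w

Satisfies₀-lowerLimit : ∀ {r w} c → lowerLimit c ≤ r → r ≤ w → Satisfies₀ w c → Satisfies₀ r c
Satisfies₀-lowerLimit {r} {w} c lim≤r r≤w s with <-cmp 0ℚ (wCoeff c)
... | tri< 0<a _ _ = from (Satisfies₀⇔ r c) (from (≤-*-pos 0<a (bound c) r) lim≤r)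
... | tri≈ _ 0≡a _ = from (Satisfies₀⇔ r c) (subst (bound c ≤_) a*w≡a*r (to (Satisfies₀⇔ w c) s))
  where
    a*w≡a*r : wCoeff c * w ≡ wCoeff c * r
    a*w≡a*r = trans (cong (_* w) (sym 0≡a)) (trans (*-zeroˡ w) (trans (sym (*-zeroˡ r)) (cong (_* r) 0≡a)))
... | tri> _ _ a<0  = from (Satisfies₀⇔ r c)
  (≤-trans (to (Satisfies₀⇔ w c) s) (*-monoˡ-≤-nonPos (wCoeff c) {{nonPositive (<⇒≤ a<0)}} r≤w))

minimum-attained₀ : ∀ {w₀} (cs : List (Constraint 0)) → All (Satisfies₀ w₀) cs →
  (∀ {w} → All (Satisfies₀ w) cs → 0ℚ ≤ w) →
  ∃[ r ] (All (Satisfies₀ r) cs × (∀ {w} → All (Satisfies₀ w) cs → r ≤ w))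
minimum-attained₀ {w₀} cs s₀ nonNeg =
  r , All.zipWith (λ {c} (lim≤r , s) → Satisfies₀-lowerLimit c lim≤r (r≤ s₀) s)
                  (All.map⁻ (Extrema.xs≤max 0ℚ (map lowerLimit cs)) , s₀)
    , r≤
  where
    r = Extrema.max 0ℚ (map lowerLimit cs)
    r≤ : ∀ {w} → All (Satisfies₀ w) cs → r ≤ w
    r≤ s = Extrema.max≤v⁺ (nonNeg s) (All.map⁺ (All.map (λ {c} → lowerLimit≤ c (nonNeg s)) s))

minimum-attained : ∀ {k x₀ w₀} (cs : List (Constraint k)) → All (Satisfies x₀ w₀) cs →
  (∀ {x w} → All (Satisfies x w) cs → 0ℚ ≤ w) →
  ∃₂ λ x r → All (Satisfies x r) cs × (∀ {x′ w} → All (Satisfies x′ w) cs → r ≤ w)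
minimum-attained {x₀ = x₀} {w₀} cs s₀ nonNeg =
  proj₁ (eliminateAll-complete r cs sr) , r , proj₂ (eliminateAll-complete r cs sr) ,
  λ {x′} {w} s → r≤ (eliminateAll-sound x′ w cs s)
  where
    optimum = minimum-attained₀ (eliminateAll cs) (eliminateAll-sound x₀ w₀ cs s₀)
                (λ {w} s → nonNeg (proj₂ (eliminateAll-complete w cs s)))
    r = proj₁ optimum
    sr = proj₁ (proj₂ optimum)
    r≤ = proj₂ (proj₂ optimum)

-- Fractional edge covers

module _ (H : Hypergraph) where

  -- Defs keeps the indicator of u ∈ e local to sumContaining; unification extracts it at γ = 0,
  -- and since it does not depend on γ it serves for every γ.
  incidence : Fin (n H) → Fin (m H) → ℚ
  incidence u = proj₁ (incidenceFor (λ _ → 0ℚ))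
    where
      incidenceFor : ∀ γ → Σ (Fin (m H) → ℚ) λ c → sumContaining H γ u ≡ sumℚ (λ e → γ e * c e)
      incidenceFor γ = _ , refl

  incidence-∈ : ∀ {u e} → u ∈ edge H e → incidence u e ≡ 1ℚ
  incidence-∈ {u} {e} u∈e with u ∈? edge H e
  ... | yes _   = refl
  ... | no  u∉e = contradiction u∈e u∉e

  incidence-∉ : ∀ {u e} → u ∉ edge H e → incidence u e ≡ 0ℚ
  incidence-∉ {u} {e} u∉e with u ∈? edge H e
  ... | yes u∈e = contradiction u∈e u∉e
  ... | no  _   = refl

  0≤incidence : ∀ u e → 0ℚ ≤ incidence u e
  0≤incidence u e with u ∈? edge H e
  ... | yes _ = 0≤1
  ... | no  _ = ≤-refl

  sumContaining-mono : ∀ {γ γ′} u → (∀ e → γ e ≤ γ′ e) → sumContaining H γ u ≤ sumContaining H γ′ u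
  sumContaining-mono u γ≤γ′ =
    sumℚ-mono (λ e → *-monoʳ-≤-nonNeg (incidence u e) {{nonNegative (0≤incidence u e)}} (γ≤γ′ e))

  sumContaining-local : ∀ {γ γ′} u → (∀ e → u ∈ edge H e → γ e ≡ γ′ e) →
    sumContaining H γ u ≡ sumContaining H γ′ u
  sumContaining-local {γ} {γ′} u agree = sumℚ-cong termwise
    where
      vanishes : ∀ δ {e} → u ∉ edge H e → δ e * incidence u e ≡ 0ℚ
      vanishes δ {e} u∉e = trans (cong (δ e *_) (incidence-∉ u∉e)) (*-zeroʳ (δ e))
      termwise : ∀ e → γ e * incidence u e ≡ γ′ e * incidence u e
      termwise e = [ (λ u∈e → cong (_* incidence u e) (agree e u∈e))
                   , (λ u∉e → trans (vanishes γ u∉e) (sym (vanishes γ′ u∉e))) ]′ (toSum (u ∈? edge H e))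

  weight-nonNeg : ∀ {U γ} → IsFracCover H U γ → 0ℚ ≤ weight H γ
  weight-nonNeg (box , _) = sumℚ-nonNeg (proj₁ ∘ box)

  allOnes-isCover : ∀ U → IsFracCover H U (λ _ → 1ℚ)
  allOnes-isCover U = (λ _ → 0≤1 , ≤-refl) , λ u _ → covered u (noIsolated H u)
    where
      covered : ∀ u → ∃[ e ] (u ∈ edge H e) → 1ℚ ≤ sumContaining H (λ _ → 1ℚ) u
      covered u (e , u∈e) =
        subst (_≤ sumContaining H (λ _ → 1ℚ) u) (trans (*-identityˡ (incidence u e)) (incidence-∈ u∈e))
          (≤-sumℚ (λ e′ → subst (_≤ 1ℚ * incidence u e′) (*-identityˡ 0ℚ)
                                (*-monoˡ-≤-nonNeg 1ℚ (0≤incidence u e′))) e)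

  module CoverLP {U : VSet (n H)} (U? : Decidable U) where

    atLeastZero atMostOne : Fin (m H) → Constraint (m H)
    atLeastZero e = constraint (unit 1ℚ e) 0ℚ 0ℚ
    atMostOne   e = constraint (unit (- 1ℚ) e) 0ℚ (- 1ℚ)

    covering : Fin (n H) → List (Constraint (m H))
    covering u with U? u
    ... | yes _ = constraint (incidence u) 0ℚ 1ℚ ∷ []
    ... | no  _ = []

    weightAtMost : Constraint (m H)
    weightAtMost = constraint (λ _ → - 1ℚ) 1ℚ 0ℚ

    constraints : List (Constraint (m H))
    constraints = tabulate atLeastZero ++ tabulate atMostOne ++ concat (tabulate covering) ++ weightAtMost ∷ []

    module _ (γ : Fin (m H) → ℚ) (w : ℚ) where

      Satisfies⇔bound≤ : ∀ c {v} → value c γ w ≡ v → Satisfies γ w c ⇔ bound c ≤ v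
      Satisfies⇔bound≤ c eq = subst (λ v → Satisfies γ w c ⇔ bound c ≤ v) eq ⇔.refl

      value-wCoeff≡0 : ∀ a b → value (constraint a 0ℚ b) γ w ≡ a · γ
      value-wCoeff≡0 a b = trans (cong (_+_ (a · γ)) (*-zeroˡ w)) (+-identityʳ (a · γ))

      Satisfies-atLeastZero : ∀ e → Satisfies γ w (atLeastZero e) ⇔ 0ℚ ≤ γ e
      Satisfies-atLeastZero e = Satisfies⇔bound≤ (atLeastZero e)
        (trans (value-wCoeff≡0 (unit 1ℚ e) 0ℚ) (trans (unit-· 1ℚ e γ) (*-identityˡ (γ e))))

      Satisfies-atMostOne : ∀ e → Satisfies γ w (atMostOne e) ⇔ γ e ≤ 1ℚ
      Satisfies-atMostOne e = ⇔.trans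
        (Satisfies⇔bound≤ (atMostOne e) (trans (value-wCoeff≡0 (unit (- 1ℚ) e) (- 1ℚ)) (unit-· (- 1ℚ) e γ)))
        (≤⇔-difference (solve 1 (λ g → (:- con 1ℚ) :* g :- (:- con 1ℚ) := con 1ℚ :- g) refl (γ e)))

      Satisfies-covering : ∀ u → All (Satisfies γ w) (covering u) ⇔ (U u → 1ℚ ≤ sumContaining H γ u)
      Satisfies-covering u with U? u
      ... | yes Uu = mk⇔ (λ { (s ∷ []) _ → to covered s }) (λ cover → from covered (cover Uu) ∷ [])
        where
          covered : Satisfies γ w (constraint (incidence u) 0ℚ 1ℚ) ⇔ 1ℚ ≤ sumContaining H γ u
          covered = Satisfies⇔bound≤ (constraint (incidence u) 0ℚ 1ℚ)
            (trans (value-wCoeff≡0 (incidence u) 1ℚ) (sumℚ-cong (λ e → *-comm (incidence u e) (γ e))))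
      ... | no ¬Uu = mk⇔ (λ _ Uu → contradiction Uu ¬Uu) (λ _ → [])

      Satisfies-weightAtMost : Satisfies γ w weightAtMost ⇔ weight H γ ≤ w
      Satisfies-weightAtMost = ⇔.trans (Satisfies⇔bound≤ weightAtMost (cong (_+ 1ℚ * w) (·-const (- 1ℚ) γ)))
        (≤⇔-difference (solve 2 (λ s w → (:- con 1ℚ) :* s :+ con 1ℚ :* w :- con 0ℚ := w :- s) refl
                          (weight H γ) w))

      sound : IsFracCover H U γ → weight H γ ≤ w → All (Satisfies γ w) constraints
      sound (box , cover) weight≤w =
        All.++⁺ (All.tabulate⁺ (λ e → from (Satisfies-atLeastZero e) (proj₁ (box e))))
        (All.++⁺ (All.tabulate⁺ (λ e → from (Satisfies-atMostOne e) (proj₂ (box e))))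
        (All.++⁺ (All.concat⁺ (All.tabulate⁺ (λ u → from (Satisfies-covering u) (cover u))))
                 (from Satisfies-weightAtMost weight≤w ∷ [])))

      complete : All (Satisfies γ w) constraints → IsFracCover H U γ × weight H γ ≤ w
      complete s =
        ((λ e → to (Satisfies-atLeastZero e) (All.tabulate⁻ sAtLeastZero e)
              , to (Satisfies-atMostOne e) (All.tabulate⁻ sAtMostOne e))
        , (λ u → to (Satisfies-covering u) (All.tabulate⁻ (All.concat⁻ sCovering) u)))
        , to Satisfies-weightAtMost (All.head sWeightAtMost)
        where
          sAtLeastZero  = proj₁ (All.++⁻ (tabulate atLeastZero) s)
          sRest₁        = proj₂ (All.++⁻ (tabulate atLeastZero) s)
          sAtMostOne    = proj₁ (All.++⁻ (tabulate atMostOne) sRest₁)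
          sRest₂        = proj₂ (All.++⁻ (tabulate atMostOne) sRest₁)
          sCovering     = proj₁ (All.++⁻ (concat (tabulate covering)) sRest₂)
          sWeightAtMost = proj₂ (All.++⁻ (concat (tabulate covering)) sRest₂)

  ρ*-exists : ∀ {U} → Decidable U → ∃[ r ] IsRhoStar H U r
  ρ*-exists {U} U? = r , (γ , cover , ≤-antisym weight≤r (least γ cover)) , least
    where
      open CoverLP U?
      optimum = minimum-attained constraints (sound (λ _ → 1ℚ) (weight H (λ _ → 1ℚ)) (allOnes-isCover U) ≤-refl)
                  (λ {γ} {w} s → ≤-trans (weight-nonNeg (proj₁ (complete γ w s))) (proj₂ (complete γ w s)))
      γ = proj₁ optimum
      r = proj₁ (proj₂ optimum)
      cover = proj₁ (complete γ r (proj₁ (proj₂ (proj₂ optimum))))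
      weight≤r = proj₂ (complete γ r (proj₁ (proj₂ (proj₂ optimum))))
      least : ∀ γ′ → IsFracCover H U γ′ → r ≤ weight H γ′
      least γ′ cover′ = proj₂ (proj₂ (proj₂ optimum)) (sound γ′ (weight H γ′) cover′ ≤-refl)

  cover-antitone : ∀ {U U′ γ} → U′ ⊆ U → IsFracCover H U γ → IsFracCover H U′ γ
  cover-antitone U′⊆U (box , cover) = box , λ u U′u → cover u (U′⊆U U′u)

  ρ*-nonNeg : ∀ {U r} → IsRhoStar H U r → 0ℚ ≤ r
  ρ*-nonNeg ((γ , cover , refl) , _) = weight-nonNeg cover

  ρ*-mono : ∀ {U U′ r r′} → U ⊆ U′ → IsRhoStar H U r → IsRhoStar H U′ r′ → r ≤ r′
  ρ*-mono U⊆U′ (_ , least) ((γ′ , cover′ , refl) , _) = least γ′ (cover-antitone U⊆U′ cover′)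

  ρ*-unique : ∀ {U r r′} → IsRhoStar H U r → IsRhoStar H U r′ → r ≡ r′
  ρ*-unique ρ ρ′ = ≤-antisym (ρ*-mono id ρ ρ′) (ρ*-mono id ρ′ ρ)

  ρ*-resp : ∀ {U U′ r} → U ⊆ U′ → U′ ⊆ U → IsRhoStar H U r → IsRhoStar H U′ r
  ρ*-resp U⊆U′ U′⊆U ((γ , cover , wγ≡r) , least) =
    (γ , cover-antitone U′⊆U cover , wγ≡r) , λ γ′ cover′ → least γ′ (cover-antitone U⊆U′ cover′)

  ρ*-subadditive : ∀ {U A B r a b} → U ⊆ A ∪ B →
    IsRhoStar H U r → IsRhoStar H A a → IsRhoStar H B b → r ≤ a + b
  ρ*-subadditive {U} U⊆A∪B (_ , least) ((α , (boxα , coverα) , refl) , _) ((β , (boxβ , coverβ) , refl) , _) =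
    ≤-trans (least γ (box , cover))
            (subst (weight H γ ≤_) (sumℚ-+ α β) (sumℚ-mono (λ e → ⊔≤+ (proj₁ (boxα e)) (proj₁ (boxβ e)))))
    where
      γ : Fin (m H) → ℚ
      γ e = α e ⊔ β e
      ⊔≤+ : ∀ {x y} → 0ℚ ≤ x → 0ℚ ≤ y → x ⊔ y ≤ x + y
      ⊔≤+ {x} {y} 0≤x 0≤y = ⊔-lub (subst (_≤ x + y) (+-identityʳ x) (+-monoʳ-≤ x 0≤y))
                                  (subst (_≤ x + y) (+-identityˡ y) (+-monoˡ-≤ y 0≤x))
      box : ∀ e → (0ℚ ≤ γ e) × (γ e ≤ 1ℚ)
      box e = ≤-trans (proj₁ (boxα e)) (p≤p⊔q (α e) (β e)) , ⊔-lub (proj₂ (boxα e)) (proj₂ (boxβ e))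
      cover : ∀ u → U u → 1ℚ ≤ sumContaining H γ u
      cover u Uu = [ (λ Au → ≤-trans (coverα u Au) (sumContaining-mono u (λ e → p≤p⊔q (α e) (β e))))
                   , (λ Bu → ≤-trans (coverβ u Bu) (sumContaining-mono u (λ e → p≤q⊔p (α e) (β e))))
                   ]′ (U⊆A∪B Uu)

  Meets : VSet (n H) → Fin (m H) → Set
  Meets A e = ∃[ u ] (A u × u ∈ edge H e)

  meets? : ∀ {A : VSet (n H)} → Decidable A → Decidable (Meets A)
  meets? A? e = any? (λ u → A? u ×-dec u ∈? edge H e)

  restrict : ∀ {A : VSet (n H)} → Decidable A → (Fin (m H) → ℚ) → Fin (m H) → ℚ
  restrict A? γ e with meets? A? e
  ... | yes _ = γ e
  ... | no  _ = 0ℚ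

  restrict-cover : ∀ {U A : VSet (n H)} {γ} (A? : Decidable A) → A ⊆ U →
    IsFracCover H U γ → IsFracCover H A (restrict A? γ)
  restrict-cover {A = A} {γ} A? A⊆U (box , cover) =
    box′ , λ u Au → subst (1ℚ ≤_) (sym (sumContaining-local u (agrees Au))) (cover u (A⊆U Au))
    where
      box′ : ∀ e → (0ℚ ≤ restrict A? γ e) × (restrict A? γ e ≤ 1ℚ)
      box′ e with meets? A? e
      ... | yes _ = box e
      ... | no  _ = ≤-refl , 0≤1
      agrees : ∀ {u} → A u → ∀ e → u ∈ edge H e → restrict A? γ e ≡ γ e
      agrees {u} Au e u∈e with meets? A? e
      ... | yes _     = refl
      ... | no ¬meets = contradiction (u , Au , u∈e) ¬meets

  ρ*-superadditive : ∀ {U A B : VSet (n H)} {s a b} (A? : Decidable A) (B? : Decidable B) → A ⊆ U → B ⊆ U →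
    (∀ {e} → Meets A e → Meets B e → ⊥) → IsRhoStar H U s → IsRhoStar H A a → IsRhoStar H B b → a + b ≤ s
  ρ*-superadditive A? B? A⊆U B⊆U disjoint ((γ , cover , refl) , _) (_ , leastA) (_ , leastB) =
    ≤-trans (+-mono-≤ (leastA _ (restrict-cover A? A⊆U cover)) (leastB _ (restrict-cover B? B⊆U cover)))
            (subst (_≤ weight H γ) (sumℚ-+ (restrict A? γ) (restrict B? γ)) (sumℚ-mono split))
    where
      split : ∀ e → restrict A? γ e + restrict B? γ e ≤ γ e
      split e with meets? A? e | meets? B? e
      ... | yes meetsA | yes meetsB = contradiction meetsB (disjoint meetsA)
      ... | yes _      | no  _      = ≤-reflexive (+-identityʳ (γ e))
      ... | no  _      | yes _      = ≤-reflexive (+-identityˡ (γ e))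
      ... | no  _      | no  _      = subst (_≤ γ e) (sym (+-identityˡ 0ℚ)) (proj₁ (proj₁ cover e))

-- Reachability in finite graphs

Star-preserves : ∀ {A : Set} {R : A → A → Set} (P : A → Set) → (∀ {x y} → R x y → P x → P y) →
  ∀ {x y} → Star R x y → P x → P y
Star-preserves P step = fold (λ x y → P x → P y) (λ r f → f ∘ step r) id

Star-exit : ∀ {A : Set} {R : A → A → Set} {P : A → Set} → Decidable P →
  ∀ {a b} → Star R a b → P a → ¬ P b → ∃₂ λ c d → R c d × P c × ¬ P d
Star-exit P? ε Pa ¬Pb = contradiction Pa ¬Pb
Star-exit P? (_◅_ {j = c} Rac path) Pa ¬Pb with P? c
... | yes Pc = Star-exit P? path Pc ¬Pb
... | no ¬Pc = _ , c , Rac , Pa , ¬Pc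

module _ {k : ℕ} {P : Fin k → Set} (P? : Decidable P) where

  fromDec : Subset k
  fromDec = tabulateᵥ (isYes ∘ P?)

  ∈-fromDec⁺ : ∀ {i} → P i → i ∈ fromDec
  ∈-fromDec⁺ {i} Pi = lookup⇒[]= i fromDec (trans (lookup∘tabulate (isYes ∘ P?) i) (to T-≡ (fromWitness Pi)))

  ∈-fromDec⁻ : ∀ {i} → i ∈ fromDec → P i
  ∈-fromDec⁻ {i} i∈ = toWitness (from T-≡ (trans (sym (lookup∘tabulate (isYes ∘ P?) i)) ([]=⇒lookup i∈)))

module _ {k : ℕ} {R : Fin k → Fin k → Set} (R? : ∀ u v → Dec (R u v)) (u : Fin k) where

  reachableWithin : ℕ → Subset k
  reachableWithin zero    = ⁅ u ⁆
  reachableWithin (suc j) =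
    fromDec (λ v → v ∈? reachableWithin j ⊎-dec any? (λ w → w ∈? reachableWithin j ×-dec R? w v))

  reachableWithin-suc : ∀ j → reachableWithin j ⊆ₛ reachableWithin (suc j)
  reachableWithin-suc j v∈ = ∈-fromDec⁺ _ (inj₁ v∈)

  reachableWithin-step : ∀ j {w v} → w ∈ reachableWithin j → R w v → v ∈ reachableWithin (suc j)
  reachableWithin-step j {w} w∈ Rwv = ∈-fromDec⁺ _ (inj₂ (w , w∈ , Rwv))

  reachableWithin-sound : ∀ j {v} → v ∈ reachableWithin j → Star R u v
  reachableWithin-sound zero    v∈ = subst (Star R u) (sym (x∈⁅y⁆⇒x≡y u v∈)) ε
  reachableWithin-sound (suc j) v∈ =
    [ reachableWithin-sound j , (λ { (w , w∈ , Rwv) → reachableWithin-sound j w∈ ◅◅ (Rwv ◅ ε) }) ]′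
      (∈-fromDec⁻ _ v∈)

  Stable : ℕ → Set
  Stable j = reachableWithin (suc j) ⊆ₛ reachableWithin j

  stable-suc : ∀ j → Stable j → Stable (suc j)
  stable-suc j stable v∈ =
    [ id , (λ { (w , w∈ , Rwv) → reachableWithin-step j (stable w∈) Rwv }) ]′ (∈-fromDec⁻ _ v∈)

  stable-or-growing : ∀ j → Stable j ⊎ suc j ℕ.≤ ∣ reachableWithin j ∣
  stable-or-growing zero = inj₂ (ℕ.≤-reflexive (sym (∣⁅x⁆∣≡1 u)))
  stable-or-growing (suc j)
    with stable-or-growing j | any? (λ v → v ∈? reachableWithin (suc j) ×-dec ¬? (v ∈? reachableWithin j))
  ... | inj₁ stable | _       = inj₁ (stable-suc j stable)
  ... | inj₂ grown  | yes new =
    inj₂ (ℕ.<-≤-trans (ℕ.s≤s grown) (p⊂q⇒∣p∣<∣q∣ (reachableWithin-suc j , new)))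
  ... | inj₂ _      | no ¬new =
    inj₁ (stable-suc j λ {v} v∈ → decidable-stable (v ∈? reachableWithin j) (λ v∉ → ¬new (v , v∈ , v∉)))

  stable : Stable k
  stable with stable-or-growing k
  ... | inj₁ stable-k  = stable-k
  ... | inj₂ k<∣reach∣ = contradiction (∣p∣≤n (reachableWithin k)) (ℕ.<⇒≱ k<∣reach∣)

  reachableWithin-complete : ∀ {v} → Star R u v → v ∈ reachableWithin k
  reachableWithin-complete path =
    Star-preserves (_∈ reachableWithin k) (λ Rwv w∈ → stable (reachableWithin-step k w∈ Rwv)) path (start k)
    where
      start : ∀ j → u ∈ reachableWithin j
      start zero    = x∈⁅x⁆ u
      start (suc j) = reachableWithin-suc j (start j)

  Star? : ∀ v → Dec (Star R u v)
  Star? v = map′ (reachableWithin-sound k) reachableWithin-complete (v ∈? reachableWithin k)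

-- Subtrees of a tree decomposition

module _ (T : Tree) where

  Node : Set
  Node = Fin (suc (t T))

  parent<child : ∀ i → parent T i <ᶠ suc i
  parent<child i = ℕ.s≤s (parentSmaller T i)

  tree-induction : ∀ {ℓ} (P : Node → Set ℓ) → P zero → (∀ i → P (parent T i) → P (suc i)) → ∀ z → P z
  tree-induction P P-root P-child z = go z (<-wellFounded z)
    where
      go : ∀ z → Acc _<ᶠ_ z → P z
      go zero    _         = P-root
      go (suc i) (acc rec) = P-child i (go (parent T i) (rec (parent<child i)))

  data Descendant (x : Node) : Node → Set where
    self  : Descendant x x
    child : ∀ {i} → Descendant x (parent T i) → Descendant x (suc i)

  Descendant? : ∀ x z → Dec (Descendant x z)
  Descendant? x = tree-induction (Dec ∘ Descendant x)
    (map′ (λ { refl → self }) (λ { self → refl }) (x ≟ᶠ zero))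
    (λ i d? → map′ [ (λ { refl → self }) , child ]′ (λ { self → inj₁ refl ; (child d) → inj₂ d })
                   ((x ≟ᶠ suc i) ⊎-dec d?))

  descendant-of-root : ∀ z → Descendant zero z
  descendant-of-root = tree-induction (Descendant zero) self (λ _ → child)

  child-on-path : ∀ {x z} → Descendant x z → z ≢ x → ∃[ j ] (parent T j ≡ x × Descendant (suc j) z)
  child-on-path self z≢x = contradiction refl z≢x
  child-on-path {x} (child {i} d) _ with parent T i ≟ᶠ x
  ... | yes pi≡x = i , pi≡x , self
  ... | no  pi≢x with child-on-path d pi≢x
  ...   | j , pj≡x , d′ = j , pj≡x , child d′

  leaving-edge : ∀ {x a b} → TAdj T a b → Descendant x a → ¬ Descendant x b →
    ∃[ i ] (x ≡ suc i × a ≡ x × b ≡ parent T i)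
  leaving-edge (inj₁ (i , refl , refl)) self      _   = i , refl , refl , refl
  leaving-edge (inj₁ (i , refl , refl)) (child d) ¬db = contradiction d ¬db
  leaving-edge (inj₂ (i , refl , refl)) d         ¬db = contradiction (child d) ¬db

module _ {H : Hypergraph} (D : TreeDecomposition H) where

  private
    T = tree D
    B = bag D

  InSubtree : Node T → VSet (n H)
  InSubtree x v = ∃[ z ] (Descendant T x z × v ∈ B z)

  InSubtree? : ∀ x → Decidable (InSubtree x)
  InSubtree? x v = any? (λ z → Descendant? T x z ×-dec v ∈? B z)

  bag-separation : ∀ {v x a b} → v ∈ B a → v ∈ B b → Descendant T x a → ¬ Descendant T x b →
    ∃[ i ] (x ≡ suc i × v ∈ B x × v ∈ B (parent T i))
  bag-separation {v} {x} {a} {b} v∈a v∈b da ¬db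
    with Star-exit (Descendant? T x) (connectedness D v a b v∈a v∈b) da ¬db
  ... | c , d , (cd , v∈c , v∈d) , dc , ¬dd with leaving-edge T cd dc ¬dd
  ...   | i , x≡si , refl , refl = i , x≡si , v∈c , v∈d

  edge-leaving-subtree : ∀ {x u v e} → u ∈ edge H e → v ∈ edge H e → InSubtree x u →
    InSubtree x v ⊎ ∃[ i ] (x ≡ suc i × u ∈ B x × u ∈ B (parent T i))
  edge-leaving-subtree {x} {u} {v} {e} u∈e v∈e (z , dz , u∈z) with coversEdges D e
  ... | y , e⊆y with Descendant? T x y
  ...   | yes dy = inj₁ (y , dy , e⊆y v v∈e)
  ...   | no ¬dy = inj₂ (bag-separation u∈z (e⊆y u u∈e) dz ¬dy)

  subtree-closed : ∀ {x u v e} → u ∉ B x → u ∈ edge H e → v ∈ edge H e → InSubtree x u → InSubtree x v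
  subtree-closed u∉x u∈e v∈e u∈W with edge-leaving-subtree u∈e v∈e u∈W
  ... | inj₁ v∈W               = v∈W
  ... | inj₂ (_ , _ , u∈x , _) = contradiction u∈x u∉x

  subtree-closed-child : ∀ {j u v e} → u ∉ B (parent T j) → u ∈ edge H e → v ∈ edge H e →
    InSubtree (suc j) u → InSubtree (suc j) v
  subtree-closed-child u∉p u∈e v∈e u∈W with edge-leaving-subtree u∈e v∈e u∈W
  ... | inj₁ v∈W                  = v∈W
  ... | inj₂ (_ , refl , _ , u∈p) = contradiction u∈p u∉p

-- The balanced separator

maxWitness : ∀ {k} {P : Fin k → Set} → Decidable P → ∃ P → ∃[ x ] (P x × ∀ {y} → x <ᶠ y → ¬ P y)
maxWitness {suc k} {P} P? (x , Px) with any? (P? ∘ suc)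
... | yes Psuc with maxWitness (P? ∘ suc) Psuc
...   | x′ , Px′ , x′-max = suc x′ , Px′ , λ { {suc y} (ℕ.s≤s x′<y) → x′-max x′<y }
maxWitness {suc k} {P} P? (zero , P0)  | no ¬Psuc = zero , P0 , λ { {suc y} _ Py → ¬Psuc (y , Py) }
maxWitness {suc k} {P} P? (suc x , Px) | no ¬Psuc = contradiction (x , Px) ¬Psuc

⅔s≤s : ∀ {s} → 0ℚ ≤ s → (+ 2 / 3) * s ≤ s
⅔s≤s {s} 0≤s = subst₂ _≤_ (solve 1 (λ s → s :- con (+ 1 / 3) :* s := con (+ 2 / 3) :* s) refl s) (+-identityʳ s)
  (+-monoʳ-≤ s (neg-antimono-≤ (*-monoˡ-≤-nonNeg (+ 1 / 3) 0≤s)))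

remainder-light : ∀ {s k a b} → (+ 3 / 1) * k < s → a + b ≤ s → (+ 2 / 3) * s ≤ a + k → b < (+ 2 / 3) * s
remainder-light {s} {k} {a} {b} 3k<s a+b≤s ⅔s≤a+k = +-cancelʳ-< (begin-strict
    b + (+ 2 / 3) * s   ≤⟨ +-monoʳ-≤ b ⅔s≤a+k ⟩
    b + (a + k)         ≡⟨ solve 3 (λ a b k → b :+ (a :+ k) := (a :+ b) :+ k) refl a b k ⟩
    (a + b) + k         ≤⟨ +-monoˡ-≤ k a+b≤s ⟩
    s + k               <⟨ +-monoʳ-< s k<⅓s ⟩
    s + (+ 1 / 3) * s   ≡⟨ solve 1 (λ s → s :+ con (+ 1 / 3) :* s := con (+ 2 / 3) :* s :+ con (+ 2 / 3) :* s) refl s ⟩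
    (+ 2 / 3) * s + (+ 2 / 3) * s ∎)
  where
    open ≤-Reasoning
    k<⅓s : k < (+ 1 / 3) * s
    k<⅓s = subst (_< (+ 1 / 3) * s) (solve 1 (λ k → con (+ 1 / 3) :* (con (+ 3 / 1) :* k) := k) refl k)
                 (*-monoʳ-<-pos (+ 1 / 3) 3k<s)
    +-cancelʳ-< : ∀ {x y c} → x + c < y + c → x < y
    +-cancelʳ-< {x} {y} {c} x+c<y+c =
      subst₂ _<_ (solve 2 (λ x c → x :+ c :- c := x) refl x c) (solve 2 (λ y c → y :+ c :- c := y) refl y c)
        (+-monoˡ-< (- c) x+c<y+c)

module Separator {H : Hypergraph} (D : TreeDecomposition H) (S : Subset (n H)) {s : ℚ}
                 (ρS : IsRhoStar H (SetOf S) s) where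

  private
    B = bag D

  SInSubtree : Node (tree D) → VSet (n H)
  SInSubtree x v = v ∈ S × InSubtree D x v

  σ : Node (tree D) → ℚ
  σ x = proj₁ (ρ*-exists H (λ v → (v ∈? S) ×-dec InSubtree? D x v))

  ρ*-SInSubtree : ∀ x → IsRhoStar H (SInSubtree x) (σ x)
  ρ*-SInSubtree x = proj₂ (ρ*-exists H (λ v → (v ∈? S) ×-dec InSubtree? D x v))

  Heavy : Node (tree D) → Set
  Heavy x = (+ 2 / 3) * s ≤ σ x

  root-heavy : Heavy zero
  root-heavy = subst ((+ 2 / 3) * s ≤_) (ρ*-unique H (ρ*-resp H S⊆SInSubtree proj₁ ρS) (ρ*-SInSubtree zero))
                 (⅔s≤s (ρ*-nonNeg H ρS))
    where
      S⊆SInSubtree : SetOf S ⊆ SInSubtree zero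
      S⊆SInSubtree {v} v∈S =
        v∈S , proj₁ (coversVertices D v) , descendant-of-root (tree D) _ , proj₂ (coversVertices D v)

  -- Children have larger indices than their parents, so the children of this node are not heavy.
  deepest-heavy : ∃[ x ] (Heavy x × ∀ {y} → x <ᶠ y → ¬ Heavy y)
  deepest-heavy = maxWitness (λ x → (+ 2 / 3) * s ≤? σ x) (zero , root-heavy)

  module _ {x : Node (tree D)} (x-heavy : Heavy x) (deeper-light : ∀ {y} → x <ᶠ y → ¬ Heavy y) where

    Adj? : ∀ u v → Dec (AdjOutside H (B x) u v)
    Adj? u v = ¬? (u ∈? B x) ×-dec ¬? (v ∈? B x) ×-dec any? (λ e → u ∈? edge H e ×-dec v ∈? edge H e)

    Component : Fin (n H) → VSet (n H)
    Component u₀ = Star (AdjOutside H (B x)) u₀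

    component-light-inside : ∀ {u₀ r} → u₀ ∉ B x → InSubtree D x u₀ →
      IsRhoStar H (Component u₀ ∩ SetOf S) r → r < (+ 2 / 3) * s
    component-light-inside {u₀} u₀∉x (z , dz , u₀∈z) ρC
      with child-on-path (tree D) dz (λ { refl → u₀∉x u₀∈z })
    ... | j , pj≡x , dj = ≤-<-trans (ρ*-mono H inChild ρC (ρ*-SInSubtree (suc j)))
                                    (≰⇒> (deeper-light (subst (_<ᶠ suc j) pj≡x (parent<child (tree D) j))))
      where
        step : ∀ {w w′} → AdjOutside H (B x) w w′ → InSubtree D (suc j) w → InSubtree D (suc j) w′
        step (w∉x , _ , e , w∈e , w′∈e) =
          subtree-closed-child D (subst (λ y → _ ∉ B y) (sym pj≡x) w∉x) w∈e w′∈e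
        inChild : Component u₀ ∩ SetOf S ⊆ SInSubtree (suc j)
        inChild (path , v∈S) = v∈S , Star-preserves (InSubtree D (suc j)) step path (z , dj , u₀∈z)

    component-light-outside : ∀ {u₀ r k ρX} → ¬ InSubtree D x u₀ → IsRhoStar H (SetOf (B x)) ρX → ρX ≤ k →
      (+ 3 / 1) * k < s → IsRhoStar H (Component u₀ ∩ SetOf S) r → r < (+ 2 / 3) * s
    component-light-outside {u₀} {k = k} u₀∉W ρX ρX≤k 3k<s ρC =
      ≤-<-trans (ρ*-mono H outside ρC ρOutside) (remainder-light {a = a} 3k<s a+b≤s ⅔s≤a+k)
      where
        Inside Outside : VSet (n H)
        Inside  v = v ∈ S × InSubtree D x v × v ∉ B x
        Outside v = v ∈ S × ¬ InSubtree D x v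
        Inside? : Decidable Inside
        Inside? v = v ∈? S ×-dec InSubtree? D x v ×-dec ¬? (v ∈? B x)
        Outside? : Decidable Outside
        Outside? v = v ∈? S ×-dec ¬? (InSubtree? D x v)
        a b : ℚ
        a = proj₁ (ρ*-exists H Inside?)
        b = proj₁ (ρ*-exists H Outside?)
        ρInside : IsRhoStar H Inside a
        ρInside = proj₂ (ρ*-exists H Inside?)
        ρOutside : IsRhoStar H Outside b
        ρOutside = proj₂ (ρ*-exists H Outside?)
        disjoint : ∀ {e} → Meets H Inside e → Meets H Outside e → ⊥
        disjoint (u , (_ , u∈W , u∉x) , u∈e) (v , (_ , v∉W) , v∈e) = v∉W (subtree-closed D u∉x u∈e v∈e u∈W)
        split : SInSubtree x ⊆ Inside ∪ SetOf (B x)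
        split {v} (v∈S , v∈W) with v ∈? B x
        ... | yes v∈x = inj₂ v∈x
        ... | no  v∉x = inj₁ (v∈S , v∈W , v∉x)
        step : ∀ {w w′} → AdjOutside H (B x) w w′ → ¬ InSubtree D x w → ¬ InSubtree D x w′
        step (_ , w′∉x , e , w∈e , w′∈e) w∉W w′∈W = w∉W (subtree-closed D w′∉x w′∈e w∈e w′∈W)
        outside : Component u₀ ∩ SetOf S ⊆ Outside
        outside (path , v∈S) = v∈S , Star-preserves (¬_ ∘ InSubtree D x) step path u₀∉W
        a+b≤s : a + b ≤ s
        a+b≤s = ρ*-superadditive H Inside? Outside? proj₁ proj₁ disjoint ρS ρInside ρOutside
        ⅔s≤a+k : (+ 2 / 3) * s ≤ a + k
        ⅔s≤a+k = ≤-trans x-heavy (≤-trans (ρ*-subadditive H split (ρ*-SInSubtree x) ρInside ρX) (+-monoʳ-≤ a ρX≤k))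

    isBalancedSep : ∀ {k ρX} → IsRhoStar H (SetOf (B x)) ρX → ρX ≤ k → (+ 3 / 1) * k < s →
      IsBalancedSep H S (B x)
    isBalancedSep ρX ρX≤k 3k<s s′ ρS′ V′ (u₀ , u₀∉x , V′⇔Component) =
      r , ρ*-resp H (λ (p , v∈S) → from (V′⇔Component _) p , v∈S) (λ (v′ , v∈S) → to (V′⇔Component _) v′ , v∈S)
                    ρC
        , subst (λ s → r < (+ 2 / 3) * s) (ρ*-unique H ρS ρS′) light
      where
        C? : Decidable (Component u₀ ∩ SetOf S)
        C? v = Star? Adj? u₀ v ×-dec v ∈? S
        r : ℚ
        r = proj₁ (ρ*-exists H C?)
        ρC : IsRhoStar H (Component u₀ ∩ SetOf S) r
        ρC = proj₂ (ρ*-exists H C?)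
        light : r < (+ 2 / 3) * s
        light with InSubtree? D x u₀
        ... | yes u₀∈W = component-light-inside u₀∉x u₀∈W ρC
        ... | no  u₀∉W = component-light-outside u₀∉W ρX ρX≤k 3k<s ρC

mainTheorem7 : (H : Hypergraph) (k : ℚ) → 0ℚ < k →
    (S : Subset (n H)) → (s : ℚ) → IsRhoStar H (SetOf S) s → (+ 3 / 1) * k < s →
    FhwAtMost H k →
    ∃[ X ] (IsBalancedSep H S X × ∃[ r ] (IsRhoStar H (SetOf X) r × r ≤ k))
mainTheorem7 H k _ S s ρS 3k<s (D , bags≤k) =
  let x , x-heavy , deeper-light = deepest-heavy
      _ , ρX , ρX≤k = bags≤k x
  in bag D x , isBalancedSep x-heavy deeper-light ρX ρX≤k 3k<s , bags≤k x
  where open Separator D S ρS
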